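{- Let $H$ be a finite graph and $a,b$ two vertices of $H$ with $ab\notin E(H)$. Then $[2]f_{a,b,H}=[2]g_{a,b,H}$ if and only if $N_H(a)\cap N_H(b)=\emptyset$.
   Context: For $p\in[0,1]$ define the kernel $U_p:[0,1]^2\to\mathbb{R}$ by $U_p(x,y)=2p-1$ if $(x,y)\in[0,1/2)^2$ or $(x,y)\in[1/2,1]^2$, and $U_p(x,y)=-1$ otherwise. Let $I_1=[0,1/2)$, $I_2=[1/2,1]$. For a graph $H$ and vertices $a,b$, define $f_{a,b,H}(p)=\int_{I_1\times I_1}\left(\int_{[0,1]^{v(H)-2}}\prod_{uv\in E(H)}U_p(x_u,x_v)\prod_{k\in V(H)\setminus\{a,b\}}dx_k\right)dx_a\,dx_b$ and $g_{a,b,H}(p)$ the same integral with the outer domain $I_1\times I_2$ instead of $I_1\times I_1$. These are polynomials in $p$; $[j]f$ denotes the coefficient of $p^j$ in a polynomial $f$. $N_H(v)$ is the neighbourhood of $v$ in $H$. -}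

module Defs where

open import Data.Bool using (Bool; true; false; if_then_else_; _∧_)
open import Data.Nat using (ℕ; zero; suc; _<ᵇ_)
open import Data.Integer using (+_; -[1+_])
open import Data.Fin using (Fin; zero; suc; toℕ)
open import Data.List using (List; []; _∷_; map; foldr; concatMap; filter; allFin; _++_)
open import Data.Rational using (ℚ; _+_; _*_; 0ℚ; 1ℚ; ½; _/_)
open import Relation.Binary.PropositionalEquality using (_≡_)
open import Data.Empty using (⊥)

record Graph : Set where
  field
    n     : ℕ
    adj   : Fin n → Fin n → Bool
    sym   : ∀ u v → adj u v ≡ adj v u
    loopless : ∀ v → adj v v ≡ false
open Graph public

-- Polynomials in p with rational coefficients, as coefficient lists
-- (head = coefficient of p^0).
Poly : Set
Poly = List ℚ

_⊕_ : Poly → Poly → Poly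
[] ⊕ q = q
(x ∷ p) ⊕ [] = x ∷ p
(x ∷ p) ⊕ (y ∷ q) = (x + y) ∷ (p ⊕ q)

scale : ℚ → Poly → Poly
scale c = map (c *_)

_⊗_ : Poly → Poly → Poly
[] ⊗ q = []
(x ∷ p) ⊗ q = scale x q ⊕ (0ℚ ∷ (p ⊗ q))

const : ℚ → Poly
const c = c ∷ []

coeff : ℕ → Poly → ℚ
coeff j [] = 0ℚ
coeff zero (x ∷ p) = x
coeff (suc j) (x ∷ p) = coeff j p

-- the two values of U_p: 2p - 1 (same part) and -1 (different parts)
samePart : Poly
samePart = (-[1+ 0 ] / 1) ∷ (+ 2 / 1) ∷ []

diffPart : Poly
diffPart = const (-[1+ 0 ] / 1)

-- U_p(x,y) for x in part s, y in part t (true = I₁ = [0,1/2), false = I₂ = [1/2,1])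
Uval : Bool → Bool → Poly
Uval true  true  = samePart
Uval false false = samePart
Uval _     _     = diffPart

assignments : (n : ℕ) → List (Fin n → Bool)
assignments zero = (λ ()) ∷ []
assignments (suc n) =
  concatMap (λ σ → (λ { zero → true ; (suc i) → σ i })
                 ∷ (λ { zero → false ; (suc i) → σ i }) ∷ [])
            (assignments n)

edgeProduct : (H : Graph) → (Fin (n H) → Bool) → Poly
edgeProduct H σ =
  foldr _⊗_ (const 1ℚ)
    (concatMap (λ u → concatMap (λ v →
        if (toℕ u <ᵇ toℕ v) ∧ adj H u v then Uval (σ u) (σ v) ∷ [] else [])
      (allFin (n H))) (allFin (n H)))

half^ : ℕ → ℚ
half^ zero = 1ℚ
half^ (suc k) = ½ * half^ k

-- Integral of ∏ U_p(x_u,x_v) over the region where x_a ∈ I₁ and x_b ∈ J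
-- (J = I₁ if sb = true, J = I₂ if sb = false). Since U_p is constant on
-- each cell I_{σ(1)} × ... × I_{σ(n)} (of measure (1/2)^n), the integral is
-- the finite sum over part assignments σ.
cellIntegral : (H : Graph) → Fin (n H) → Fin (n H) → Bool → Poly
cellIntegral H a b sb =
  foldr _⊕_ []
    (map (λ σ → if (σ a ∧ eqB (σ b) sb)
                  then scale (half^ (n H)) (edgeProduct H σ) else [])
         (assignments (n H)))
  where
  eqB : Bool → Bool → Bool
  eqB true true = true
  eqB false false = true
  eqB _ _ = false

f : (H : Graph) → Fin (n H) → Fin (n H) → Poly
f H a b = cellIntegral H a b true

g : (H : Graph) → Fin (n H) → Fin (n H) → Poly
g H a b = cellIntegral H a b false

CommonNbrsEmpty : (H : Graph) → Fin (n H) → Fin (n H) → Set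
CommonNbrsEmpty H a b = ∀ v → adj H a v ≡ true → adj H b v ≡ true → ⊥

-- Let σ range over the 2^n assignments of the vertices to I₁ (true) and I₂ (false), and let
-- s_v = ±1 accordingly. On the cell of σ the integrand is ∏_{uv ∈ E} (−1 + p (1 + s_u s_v)), whose
-- p²-coefficient is (−1)^{e(H)} times the sum of (1 + s_u s_v)(1 + s_u′ s_v′) over pairs of distinct
-- edges. Since [x_a ∈ I₁] = (1 + s_a)/2 and [x_b ∈ I₁] − [x_b ∈ I₂] = s_b, this gives
--   [2]f − [2]g = 2^{−n} (−1)^{e(H)} Σ_{pairs} ½ Σ_σ (1 + s_a) s_b (1 + s_u s_v)(1 + s_u′ s_v′).
-- Summed over σ, a monomial ∏ s_v gives 2^n if every vertex occurs in it an even number of times and 0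
-- otherwise. As a ≠ b and ab ∉ E, only s_a s_b s_u s_v s_u′ s_v′ can survive, and it does exactly when
-- {u, v} = {a, w} and {u′, v′} = {b, w} for a common neighbour w. So [2]f − [2]g is a nonzero multiple
-- of a sum of nonnegative terms, which is positive precisely when N(a) ∩ N(b) ≠ ∅.
module Submission where

open import Data.Bool using (Bool; true; false; if_then_else_; _∧_; not; T)
open import Data.Bool.Properties using (not-¬)
open import Data.Empty using (⊥-elim)
open import Data.Fin using (Fin; zero; suc; toℕ)
import Data.Fin.Properties as Fin
open import Data.List using (List; []; _∷_; _++_; map; foldr; concatMap; allFin; length; filter)
open import Data.List.Membership.Propositional using (_∈_)
open import Data.List.Membership.Propositional.Properties
  using (∈-map⁺; ∈-map⁻; ∈-++⁺ˡ; ∈-++⁺ʳ; ∈-++⁻; ∈-concatMap⁺; ∈-concatMap⁻; ∈-allFin)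
open import Data.List.Properties using (filter-accept; filter-reject; map-concatMap; concatMap-cong)
open import Data.List.Relation.Binary.Permutation.Propositional using (_↭_; ↭-refl; ↭-prep; ↭-swap; ↭-trans)
open import Data.List.Relation.Binary.Permutation.Propositional.Properties using (↭-length; filter-↭; shift)
open import Data.List.Relation.Unary.Any as Any using (here; there; _─_; satisfied)
open import Data.Maybe using (Maybe; just; nothing)
open import Data.Nat using (ℕ; zero; suc; parity; _<ᵇ_)
import Data.Nat as ℕ
import Data.Nat.Properties as ℕ
open import Data.Parity using (Parity; 0ℙ; 1ℙ)
import Data.Parity as ℙ
import Data.Parity.Properties as Parity
open import Data.Product using (_×_; _,_; proj₁; proj₂; ∃-syntax; Σ-syntax)
open import Data.Rational using (ℚ; _+_; _*_; _-_; -_; 0ℚ; 1ℚ; ½; _≤_; _<_)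
import Data.Rational.Properties as ℚ
open import Algebra.Definitions.RawSemiring ℚ.+-*-rawSemiring using (_^_)
import Algebra.Properties.Group ℚ.+-0-group as Group
open import Data.Sum as Sum using (_⊎_; inj₁; inj₂)
open import Defs hiding (sym)
open import Function using (_∘_)
open import Level using (0ℓ)
open import Relation.Binary.Definitions using (DecidableEquality; tri<; tri≈; tri>)
open import Relation.Binary.PropositionalEquality
  using (_≡_; refl; sym; trans; cong; cong₂; subst; module ≡-Reasoning)
open import Relation.Nullary using (¬_; Dec; yes; no)
open import Tactic.RingSolver using (solve-∀)
import Tactic.RingSolver.Core.AlmostCommutativeRing as ACR

ℚ-ring : ACR.AlmostCommutativeRing 0ℓ 0ℓ
ℚ-ring = ACR.fromCommutativeRing ℚ.+-*-commutativeRing isZero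
  where
  isZero : ∀ x → Maybe (0ℚ ≡ x)
  isZero x with 0ℚ ℚ.≟ x
  ... | yes 0≡x = just 0≡x
  ... | no _ = nothing

∑ : {A : Set} → List A → (A → ℚ) → ℚ
∑ [] F = 0ℚ
∑ (x ∷ xs) F = F x + ∑ xs F

infix 5 ∑
syntax ∑ xs (λ x → F) = ∑[ x ← xs ] F

module _ {A : Set} where

  ∑-cong-∈ : (xs : List A) {F G : A → ℚ} → (∀ {x} → x ∈ xs → F x ≡ G x) → ∑ xs F ≡ ∑ xs G
  ∑-cong-∈ [] F≡G = refl
  ∑-cong-∈ (x ∷ xs) F≡G = cong₂ _+_ (F≡G (here refl)) (∑-cong-∈ xs (F≡G ∘ there))

  ∑-cong : (xs : List A) {F G : A → ℚ} → (∀ x → F x ≡ G x) → ∑ xs F ≡ ∑ xs G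
  ∑-cong xs F≡G = ∑-cong-∈ xs (λ {x} _ → F≡G x)

  ∑-zero : (xs : List A) → ∑[ x ← xs ] 0ℚ ≡ 0ℚ
  ∑-zero [] = refl
  ∑-zero (x ∷ xs) = trans (ℚ.+-identityˡ _) (∑-zero xs)

  ∑-+ : (xs : List A) (F G : A → ℚ) → ∑[ x ← xs ] (F x + G x) ≡ ∑ xs F + ∑ xs G
  ∑-+ [] F G = refl
  ∑-+ (x ∷ xs) F G = trans (cong (F x + G x +_) (∑-+ xs F G)) (interchange (F x) (G x) (∑ xs F) (∑ xs G))
    where
    interchange : ∀ a b c d → (a + b) + (c + d) ≡ (a + c) + (b + d)
    interchange = solve-∀ ℚ-ring

  ∑-*ˡ : (xs : List A) (c : ℚ) (F : A → ℚ) → ∑[ x ← xs ] (c * F x) ≡ c * ∑ xs F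
  ∑-*ˡ [] c F = sym (ℚ.*-zeroʳ c)
  ∑-*ˡ (x ∷ xs) c F = trans (cong (c * F x +_) (∑-*ˡ xs c F)) (sym (ℚ.*-distribˡ-+ c (F x) (∑ xs F)))

  ∑-- : (xs : List A) (F G : A → ℚ) → ∑[ x ← xs ] (F x - G x) ≡ ∑ xs F - ∑ xs G
  ∑-- xs F G = begin
    ∑[ x ← xs ] (F x - G x)              ≡⟨ ∑-cong xs (λ x → as-sum (F x) (G x)) ⟩
    ∑[ x ← xs ] (F x + (- 1ℚ) * G x)     ≡⟨ ∑-+ xs F (λ x → - 1ℚ * G x) ⟩
    ∑ xs F + ∑ xs (λ x → - 1ℚ * G x)     ≡⟨ cong (∑ xs F +_) (∑-*ˡ xs (- 1ℚ) G) ⟩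
    ∑ xs F + (- 1ℚ) * ∑ xs G             ≡⟨ as-sum (∑ xs F) (∑ xs G) ⟨
    ∑ xs F - ∑ xs G                      ∎
    where
    open ≡-Reasoning
    as-sum : ∀ a b → a - b ≡ a + (- 1ℚ) * b
    as-sum = solve-∀ ℚ-ring

  ∑-++ : (xs ys : List A) (F : A → ℚ) → ∑ (xs ++ ys) F ≡ ∑ xs F + ∑ ys F
  ∑-++ [] ys F = sym (ℚ.+-identityˡ _)
  ∑-++ (x ∷ xs) ys F = trans (cong (F x +_) (∑-++ xs ys F)) (sym (ℚ.+-assoc (F x) (∑ xs F) (∑ ys F)))

  ∑-nonneg : (xs : List A) {F : A → ℚ} → (∀ {x} → x ∈ xs → 0ℚ ≤ F x) → 0ℚ ≤ ∑ xs F
  ∑-nonneg [] F≥0 = ℚ.≤-refl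
  ∑-nonneg (x ∷ xs) F≥0 = ℚ.+-mono-≤ (F≥0 (here refl)) (∑-nonneg xs (F≥0 ∘ there))

  ∑-pos : (xs : List A) {F : A → ℚ} {x : A} → x ∈ xs → 0ℚ < F x → (∀ {y} → y ∈ xs → 0ℚ ≤ F y) → 0ℚ < ∑ xs F
  ∑-pos (y ∷ xs) (here refl) Fx>0 F≥0 = ℚ.+-mono-<-≤ Fx>0 (∑-nonneg xs (F≥0 ∘ there))
  ∑-pos (y ∷ xs) (there x∈xs) Fx>0 F≥0 = ℚ.+-mono-≤-< (F≥0 (here refl)) (∑-pos xs x∈xs Fx>0 (F≥0 ∘ there))

module _ {A B : Set} where

  ∑-comm : (xs : List A) (ys : List B) (F : A → B → ℚ) →
    ∑[ x ← xs ] ∑[ y ← ys ] F x y ≡ ∑[ y ← ys ] ∑[ x ← xs ] F x y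
  ∑-comm [] ys F = sym (∑-zero ys)
  ∑-comm (x ∷ xs) ys F = trans (cong (∑ ys (F x) +_) (∑-comm xs ys F)) (sym (∑-+ ys (F x) (λ y → ∑[ x ← xs ] F x y)))

  ∑-map : (φ : A → B) (xs : List A) (F : B → ℚ) → ∑ (map φ xs) F ≡ ∑ xs (F ∘ φ)
  ∑-map φ [] F = refl
  ∑-map φ (x ∷ xs) F = cong (F (φ x) +_) (∑-map φ xs F)

  ∑-concatMap : (φ : A → List B) (xs : List A) (F : B → ℚ) → ∑ (concatMap φ xs) F ≡ ∑[ x ← xs ] ∑ (φ x) F
  ∑-concatMap φ [] F = refl
  ∑-concatMap φ (x ∷ xs) F = trans (∑-++ (φ x) (concatMap φ xs) F) (cong (∑ (φ x) F +_) (∑-concatMap φ xs F))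

pairs : {A : Set} → List A → List (A × A)
pairs [] = []
pairs (x ∷ xs) = map (x ,_) xs ++ pairs xs

module _ {A : Set} where

  ∑-pairs-∷ : (x : A) (xs : List A) (K : A × A → ℚ) →
    ∑ (pairs (x ∷ xs)) K ≡ (∑[ y ← xs ] K (x , y)) + ∑ (pairs xs) K
  ∑-pairs-∷ x xs K = trans (∑-++ (map (x ,_) xs) (pairs xs) K) (cong (_+ ∑ (pairs xs) K) (∑-map (x ,_) xs K))

  ∈-pairs⁻ : (xs : List A) {p : A × A} → p ∈ pairs xs → proj₁ p ∈ xs × proj₂ p ∈ xs
  ∈-pairs⁻ (x ∷ xs) p∈ with ∈-++⁻ (map (x ,_) xs) p∈
  ... | inj₁ p∈map with ∈-map⁻ (x ,_) p∈map
  ...   | y , y∈xs , refl = here refl , there y∈xs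
  ∈-pairs⁻ (x ∷ xs) p∈ | inj₂ p∈pairs with ∈-pairs⁻ xs p∈pairs
  ...   | x∈xs , y∈xs = there x∈xs , there y∈xs

  ∈-pairs⁺ : {xs : List A} {x y : A} → x ∈ xs → y ∈ xs → ¬ x ≡ y → (x , y) ∈ pairs xs ⊎ (y , x) ∈ pairs xs
  ∈-pairs⁺ (here refl) (here refl) x≢y = ⊥-elim (x≢y refl)
  ∈-pairs⁺ (here refl) (there y∈xs) x≢y = inj₁ (∈-++⁺ˡ (∈-map⁺ _ y∈xs))
  ∈-pairs⁺ (there x∈xs) (here refl) x≢y = inj₂ (∈-++⁺ˡ (∈-map⁺ _ x∈xs))
  ∈-pairs⁺ {z ∷ xs} (there x∈xs) (there y∈xs) x≢y =
    Sum.map (∈-++⁺ʳ (map (z ,_) xs)) (∈-++⁺ʳ (map (z ,_) xs)) (∈-pairs⁺ x∈xs y∈xs x≢y)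

∈-if-∧⁺ : ∀ {A : Set} {x : A} {b c} → T b → c ≡ true → x ∈ (if b ∧ c then x ∷ [] else [])
∈-if-∧⁺ {b = true} _ refl = here refl

∈-if-∧⁻ : ∀ {A : Set} {x y : A} b c → y ∈ (if b ∧ c then x ∷ [] else []) → c ≡ true × y ≡ x
∈-if-∧⁻ true true (here y≡x) = refl , y≡x

∈-concatMap-intro : ∀ {A B : Set} (φ : A → List B) {x xs y} → x ∈ xs → y ∈ φ x → y ∈ concatMap φ xs
∈-concatMap-intro φ x∈xs y∈φx = ∈-concatMap⁺ φ (Any.map (λ { refl → y∈φx }) x∈xs)

coeff-⊕ : ∀ j p q → coeff j (p ⊕ q) ≡ coeff j p + coeff j q
coeff-⊕ j [] q = sym (ℚ.+-identityˡ _)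
coeff-⊕ zero (x ∷ p) [] = sym (ℚ.+-identityʳ x)
coeff-⊕ (suc j) (x ∷ p) [] = sym (ℚ.+-identityʳ _)
coeff-⊕ zero (x ∷ p) (y ∷ q) = refl
coeff-⊕ (suc j) (x ∷ p) (y ∷ q) = coeff-⊕ j p q

coeff-scale : ∀ j c p → coeff j (scale c p) ≡ c * coeff j p
coeff-scale j c [] = sym (ℚ.*-zeroʳ c)
coeff-scale zero c (x ∷ p) = refl
coeff-scale (suc j) c (x ∷ p) = coeff-scale j c p

coeff-∑⊕ : {A : Set} (j : ℕ) (P : A → Poly) (xs : List A) →
  coeff j (foldr _⊕_ [] (map P xs)) ≡ ∑[ x ← xs ] coeff j (P x)
coeff-∑⊕ j P [] = refl
coeff-∑⊕ j P (x ∷ xs) = trans (coeff-⊕ j (P x) _) (cong (coeff j (P x) +_) (coeff-∑⊕ j P xs))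

coeff₀-∷-⊗ : ∀ x p r → coeff 0 ((x ∷ p) ⊗ r) ≡ x * coeff 0 r
coeff₀-∷-⊗ x p r = trans (coeff-⊕ 0 (scale x r) _) (trans (ℚ.+-identityʳ _) (coeff-scale 0 x r))

coeff-suc-∷-⊗ : ∀ j x p r → coeff (suc j) ((x ∷ p) ⊗ r) ≡ x * coeff (suc j) r + coeff j (p ⊗ r)
coeff-suc-∷-⊗ j x p r = trans (coeff-⊕ (suc j) (scale x r) _) (cong (_+ coeff j (p ⊗ r)) (coeff-scale (suc j) x r))

coeff-const-⊗ : ∀ j x r → coeff j (const x ⊗ r) ≡ x * coeff j r
coeff-const-⊗ zero x r = coeff₀-∷-⊗ x [] r
coeff-const-⊗ (suc j) x r = trans (coeff-suc-∷-⊗ j x [] r) (ℚ.+-identityʳ _)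

𝟙 : Bool → ℚ
𝟙 true = 1ℚ
𝟙 false = 0ℚ

spin : Bool → ℚ
spin true = 1ℚ
spin false = - 1ℚ

agreement : Bool → Bool → ℚ
agreement s t = 1ℚ + spin s * spin t

𝟙-∧ : ∀ x y → 𝟙 (x ∧ y) ≡ 𝟙 x * 𝟙 y
𝟙-∧ true true = refl
𝟙-∧ true false = refl
𝟙-∧ false true = refl
𝟙-∧ false false = refl

coeff-if : ∀ j c P → coeff j (if c then P else []) ≡ 𝟙 c * coeff j P
coeff-if j true P = sym (ℚ.*-identityˡ (coeff j P))
coeff-if j false P = sym (ℚ.*-zeroˡ (coeff j P))

𝟙≡½[1+spin] : ∀ x → 𝟙 x ≡ ½ * (1ℚ + spin x)
𝟙≡½[1+spin] true = refl
𝟙≡½[1+spin] false = refl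

agreement-comm : ∀ s t → agreement s t ≡ agreement t s
agreement-comm s t = cong (1ℚ +_) (ℚ.*-comm (spin s) (spin t))

ε : Parity → ℚ
ε 0ℙ = 1ℚ
ε 1ℙ = - 1ℚ

spin-true-^ : ∀ k → spin true ^ k ≡ 1ℚ
spin-true-^ zero = refl
spin-true-^ (suc k) = trans (ℚ.*-identityˡ _) (spin-true-^ k)

spin-false-^ : ∀ k → spin false ^ k ≡ ε (parity k)
spin-false-^ zero = refl
spin-false-^ (suc zero) = refl
spin-false-^ (suc (suc k)) = trans (neg-neg (spin false ^ k)) (spin-false-^ k)
  where
  neg-neg : ∀ x → - 1ℚ * (- 1ℚ * x) ≡ x
  neg-neg = solve-∀ ℚ-ring

-1^*-1^ : ∀ k → (- 1ℚ) ^ k * (- 1ℚ) ^ k ≡ 1ℚ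
-1^*-1^ k = trans (cong₂ _*_ (spin-false-^ k) (spin-false-^ k)) (ε-square (parity k))
  where
  ε-square : ∀ p → ε p * ε p ≡ 1ℚ
  ε-square 0ℙ = refl
  ε-square 1ℙ = refl

twice : ∀ x → (1ℚ + 1ℚ) * x ≡ x + x
twice = solve-∀ ℚ-ring

coeff₀-Uval-⊗ : ∀ s t r → coeff 0 (Uval s t ⊗ r) ≡ - 1ℚ * coeff 0 r
coeff₀-Uval-⊗ true true r = coeff₀-∷-⊗ (- 1ℚ) (const (1ℚ + 1ℚ)) r
coeff₀-Uval-⊗ true false r = coeff₀-∷-⊗ (- 1ℚ) [] r
coeff₀-Uval-⊗ false true r = coeff₀-∷-⊗ (- 1ℚ) [] r
coeff₀-Uval-⊗ false false r = coeff₀-∷-⊗ (- 1ℚ) (const (1ℚ + 1ℚ)) r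

coeff-suc-samePart-⊗ : ∀ j r → coeff (suc j) (samePart ⊗ r) ≡ - 1ℚ * coeff (suc j) r + (1ℚ + 1ℚ) * coeff j r
coeff-suc-samePart-⊗ j r =
  trans (coeff-suc-∷-⊗ j (- 1ℚ) (const (1ℚ + 1ℚ)) r) (cong (- 1ℚ * coeff (suc j) r +_) (coeff-const-⊗ j (1ℚ + 1ℚ) r))

coeff-suc-diffPart-⊗ : ∀ j r → coeff (suc j) (diffPart ⊗ r) ≡ - 1ℚ * coeff (suc j) r + 0ℚ * coeff j r
coeff-suc-diffPart-⊗ j r =
  trans (coeff-suc-∷-⊗ j (- 1ℚ) [] r) (cong (- 1ℚ * coeff (suc j) r +_) (sym (ℚ.*-zeroˡ (coeff j r))))

coeff-suc-Uval-⊗ : ∀ j s t r → coeff (suc j) (Uval s t ⊗ r) ≡ - 1ℚ * coeff (suc j) r + agreement s t * coeff j r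
coeff-suc-Uval-⊗ j true true r = coeff-suc-samePart-⊗ j r
coeff-suc-Uval-⊗ j true false r = coeff-suc-diffPart-⊗ j r
coeff-suc-Uval-⊗ j false true r = coeff-suc-diffPart-⊗ j r
coeff-suc-Uval-⊗ j false false r = coeff-suc-samePart-⊗ j r

∏ : List Poly → Poly
∏ = foldr _⊗_ (const 1ℚ)

module _ {A : Set} (s t : A → Bool) where

  private
    factor : A → Poly
    factor e = Uval (s e) (t e)

    weight : A → ℚ
    weight e = agreement (s e) (t e)

  coeff₀-∏Uval : ∀ es → coeff 0 (∏ (map factor es)) ≡ (- 1ℚ) ^ length es
  coeff₀-∏Uval [] = refl
  coeff₀-∏Uval (e ∷ es) = trans (coeff₀-Uval-⊗ (s e) (t e) _) (cong (- 1ℚ *_) (coeff₀-∏Uval es))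

  coeff₁-∏Uval : ∀ es → coeff 1 (∏ (map factor es)) ≡ (- 1ℚ) ^ suc (length es) * ∑ es weight
  coeff₁-∏Uval [] = refl
  coeff₁-∏Uval (e ∷ es) = begin
    coeff 1 (factor e ⊗ r)
      ≡⟨ coeff-suc-Uval-⊗ 0 (s e) (t e) r ⟩
    - 1ℚ * coeff 1 r + weight e * coeff 0 r
      ≡⟨ cong₂ (λ c₁ c₀ → - 1ℚ * c₁ + weight e * c₀) (coeff₁-∏Uval es) (coeff₀-∏Uval es) ⟩
    - 1ℚ * ((- 1ℚ * ±) * ∑ es weight) + weight e * ±
      ≡⟨ step (weight e) ± (∑ es weight) ⟩
    (- 1ℚ * (- 1ℚ * ±)) * (weight e + ∑ es weight) ∎
    where
    open ≡-Reasoning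
    r = ∏ (map factor es)
    ± = (- 1ℚ) ^ length es
    step : ∀ w x Σ → - 1ℚ * ((- 1ℚ * x) * Σ) + w * x ≡ (- 1ℚ * (- 1ℚ * x)) * (w + Σ)
    step = solve-∀ ℚ-ring

  coeff₂-∏Uval : ∀ es →
    coeff 2 (∏ (map factor es)) ≡ (- 1ℚ) ^ length es * (∑[ p ← pairs es ] weight (proj₁ p) * weight (proj₂ p))
  coeff₂-∏Uval [] = refl
  coeff₂-∏Uval (e ∷ es) = begin
    coeff 2 (factor e ⊗ r)
      ≡⟨ coeff-suc-Uval-⊗ 1 (s e) (t e) r ⟩
    - 1ℚ * coeff 2 r + weight e * coeff 1 r
      ≡⟨ cong₂ (λ c₂ c₁ → - 1ℚ * c₂ + weight e * c₁) (coeff₂-∏Uval es) (coeff₁-∏Uval es) ⟩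
    - 1ℚ * (± * P) + weight e * ((- 1ℚ * ±) * ∑ es weight)
      ≡⟨ step (weight e) ± (∑ es weight) P ⟩
    (- 1ℚ * ±) * (weight e * ∑ es weight + P)
      ≡⟨ cong (λ x → (- 1ℚ * ±) * (x + P)) (∑-*ˡ es (weight e) weight) ⟨
    (- 1ℚ * ±) * ((∑[ y ← es ] weight e * weight y) + P)
      ≡⟨ cong ((- 1ℚ * ±) *_) (∑-pairs-∷ e es _) ⟨
    (- 1ℚ * ±) * (∑[ p ← pairs (e ∷ es) ] weight (proj₁ p) * weight (proj₂ p)) ∎
    where
    open ≡-Reasoning
    r = ∏ (map factor es)
    ± = (- 1ℚ) ^ length es
    P = ∑[ p ← pairs es ] weight (proj₁ p) * weight (proj₂ p)
    step : ∀ w x Σ P → - 1ℚ * (x * P) + w * ((- 1ℚ * x) * Σ) ≡ (- 1ℚ * x) * (w * Σ + P)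
    step = solve-∀ ℚ-ring

-- Lists in which every element occurs an even number of times

module Occurrences {A : Set} (_≟_ : DecidableEquality A) where

  occurrences : A → List A → ℕ
  occurrences x = length ∘ filter (x ≟_)

  EvenOccurrences : List A → Set
  EvenOccurrences xs = ∀ x → parity (occurrences x xs) ≡ 0ℙ

  evenOccurrences-[] : EvenOccurrences []
  evenOccurrences-[] x = refl

  evenOccurrences-↭ : {xs ys : List A} → xs ↭ ys → EvenOccurrences xs → EvenOccurrences ys
  evenOccurrences-↭ xs↭ys even x = trans (cong parity (sym (↭-length (filter-↭ (x ≟_) xs↭ys)))) (even x)

  occurrences-≡ : ∀ {x y} ys → x ≡ y → occurrences x (y ∷ ys) ≡ suc (occurrences x ys)
  occurrences-≡ {x} ys x≡y = cong length (filter-accept (x ≟_) x≡y)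

  occurrences-≢ : ∀ {x y} ys → ¬ x ≡ y → occurrences x (y ∷ ys) ≡ occurrences x ys
  occurrences-≢ {x} ys x≢y = cong length (filter-reject (x ≟_) x≢y)

  parity-occurrences-∷∷ : ∀ y x xs → Dec (y ≡ x) →
    parity (occurrences y (x ∷ x ∷ xs)) ≡ parity (occurrences y xs)
  parity-occurrences-∷∷ y x xs (yes y≡x) =
    cong parity (trans (occurrences-≡ (x ∷ xs) y≡x) (cong suc (occurrences-≡ xs y≡x)))
  parity-occurrences-∷∷ y x xs (no y≢x) =
    cong parity (trans (occurrences-≢ (x ∷ xs) y≢x) (occurrences-≢ xs y≢x))

  evenOccurrences-∷∷⁺ : ∀ {x xs} → EvenOccurrences xs → EvenOccurrences (x ∷ x ∷ xs)
  evenOccurrences-∷∷⁺ {x} {xs} even y = trans (parity-occurrences-∷∷ y x xs (y ≟ x)) (even y)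

  evenOccurrences-∷∷⁻ : ∀ {x xs} → EvenOccurrences (x ∷ x ∷ xs) → EvenOccurrences xs
  evenOccurrences-∷∷⁻ {x} {xs} even y = trans (sym (parity-occurrences-∷∷ y x xs (y ≟ x))) (even y)

  odd-occurrences⇒∈ : ∀ {x} xs → parity (suc (occurrences x xs)) ≡ 0ℙ → x ∈ xs
  odd-occurrences⇒∈ {x} (y ∷ ys) odd = by-cases (x ≟ y)
    where
    by-cases : Dec (x ≡ y) → x ∈ y ∷ ys
    by-cases (yes x≡y) = here x≡y
    by-cases (no x≢y) = there (odd-occurrences⇒∈ ys (trans (cong (parity ∘ suc) (sym (occurrences-≢ ys x≢y))) odd))

  ↭-─ : ∀ {x : A} {xs} (x∈xs : x ∈ xs) → xs ↭ x ∷ (xs ─ x∈xs)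
  ↭-─ (here refl) = ↭-refl
  ↭-─ {xs = y ∷ ys} (there x∈ys) = ↭-trans (↭-prep y (↭-─ x∈ys)) (↭-swap y _ ↭-refl)

  evenOccurrences-∷⁻ : ∀ {x xs} → EvenOccurrences (x ∷ xs) → Σ[ x∈xs ∈ x ∈ xs ] EvenOccurrences (xs ─ x∈xs)
  evenOccurrences-∷⁻ {x} {xs} even = x∈xs , evenOccurrences-∷∷⁻ (evenOccurrences-↭ (↭-prep x (↭-─ x∈xs)) even)
    where
    x∈xs : x ∈ xs
    x∈xs = odd-occurrences⇒∈ xs (trans (cong parity (sym (occurrences-≡ xs refl))) (even x))

  evenOccurrences-pair : ∀ {x y} → EvenOccurrences (x ∷ y ∷ []) → x ≡ y
  evenOccurrences-pair even with evenOccurrences-∷⁻ even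
  ... | here x≡y , _ = x≡y

  evenOccurrences-abawbw : ∀ (a b w : A) → EvenOccurrences (a ∷ b ∷ a ∷ w ∷ b ∷ w ∷ [])
  evenOccurrences-abawbw a b w =
    evenOccurrences-↭ (↭-prep a (↭-trans (↭-swap a b ↭-refl) (↭-prep b (↭-prep a (↭-swap b w ↭-refl)))))
      (evenOccurrences-∷∷⁺ (evenOccurrences-∷∷⁺ (evenOccurrences-∷∷⁺ evenOccurrences-[])))

open module FinOccurrences {m} = Occurrences (Fin._≟_ {m})

predecessors : ∀ {m} → List (Fin (suc m)) → List (Fin m)
predecessors [] = []
predecessors (zero ∷ xs) = predecessors xs
predecessors (suc x ∷ xs) = x ∷ predecessors xs

occurrences-suc : ∀ {m} (x : Fin m) xs → occurrences (suc x) xs ≡ occurrences x (predecessors xs)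
occurrences-suc x [] = refl
occurrences-suc x (zero ∷ xs) = occurrences-suc x xs
occurrences-suc x (suc y ∷ xs) = by-cases (x Fin.≟ y)
  where
  by-cases : Dec (x ≡ y) → occurrences (suc x) (suc y ∷ xs) ≡ occurrences x (y ∷ predecessors xs)
  by-cases (yes x≡y) =
    trans (occurrences-≡ xs (cong suc x≡y)) (trans (cong suc (occurrences-suc x xs)) (sym (occurrences-≡ _ x≡y)))
  by-cases (no x≢y) =
    trans (occurrences-≢ xs (x≢y ∘ Fin.suc-injective)) (trans (occurrences-suc x xs) (sym (occurrences-≢ _ x≢y)))

length-predecessors : ∀ {m} (xs : List (Fin (suc m))) → length xs ≡ occurrences zero xs ℕ.+ length (predecessors xs)
length-predecessors [] = refl
length-predecessors (zero ∷ xs) = cong suc (length-predecessors xs)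
length-predecessors (suc x ∷ xs) = trans (cong suc (length-predecessors xs)) (sym (ℕ.+-suc _ _))

evenOccurrences-predecessors : ∀ {m} (xs : List (Fin (suc m))) → EvenOccurrences xs → EvenOccurrences (predecessors xs)
evenOccurrences-predecessors xs even x = trans (cong parity (sym (occurrences-suc x xs))) (even (suc x))

evenOccurrences-from-predecessors : ∀ {m} (xs : List (Fin (suc m))) →
  parity (occurrences zero xs) ≡ 0ℙ → EvenOccurrences (predecessors xs) → EvenOccurrences xs
evenOccurrences-from-predecessors xs even₀ even zero = even₀
evenOccurrences-from-predecessors xs even₀ even (suc x) = trans (cong parity (occurrences-suc x xs)) (even x)

evenOccurrences⇒even-length : ∀ {m} (xs : List (Fin m)) → EvenOccurrences xs → parity (length xs) ≡ 0ℙ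
evenOccurrences⇒even-length {zero} [] even = refl
evenOccurrences⇒even-length {suc m} xs even = begin
  parity (length xs)                                                  ≡⟨ cong parity (length-predecessors xs) ⟩
  parity (occurrences zero xs ℕ.+ length (predecessors xs))           ≡⟨ Parity.+-homo-+ (occurrences zero xs) _ ⟩
  parity (occurrences zero xs) ℙ.+ parity (length (predecessors xs))  ≡⟨ cong₂ ℙ._+_ (even zero) IH ⟩
  0ℙ                                                                  ∎
  where
  open ≡-Reasoning
  IH = evenOccurrences⇒even-length (predecessors xs) (evenOccurrences-predecessors xs even)

¬evenOccurrences-odd : ∀ {m} (xs : List (Fin m)) → parity (length xs) ≡ 1ℙ → ¬ EvenOccurrences xs
¬evenOccurrences-odd xs odd even with trans (sym odd) (evenOccurrences⇒even-length xs even)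
... | ()

-- Character sums over the assignments

spinProduct : ∀ {m} → (Fin m → Bool) → List (Fin m) → ℚ
spinProduct σ [] = 1ℚ
spinProduct σ (x ∷ xs) = spin (σ x) * spinProduct σ xs

characterSum : ∀ {m} → List (Fin m) → ℚ
characterSum {m} xs = ∑[ σ ← assignments m ] spinProduct σ xs

spinProduct-split : ∀ {m} {σ : Fin (suc m) → Bool} {τ : Fin m → Bool} {c} → σ zero ≡ c → (∀ i → σ (suc i) ≡ τ i) →
  ∀ xs → spinProduct σ xs ≡ spin c ^ occurrences zero xs * spinProduct τ (predecessors xs)
spinProduct-split σ₀ σₛ [] = refl
spinProduct-split {c = c} σ₀ σₛ (zero ∷ xs) =
  trans (cong₂ _*_ (cong spin σ₀) (spinProduct-split σ₀ σₛ xs)) (sym (ℚ.*-assoc (spin c) _ _))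
spinProduct-split {τ = τ} {c} σ₀ σₛ (suc i ∷ xs) =
  trans (cong₂ _*_ (cong spin (σₛ i)) (spinProduct-split σ₀ σₛ xs))
        (*-left-comm (spin (τ i)) (spin c ^ occurrences zero xs) (spinProduct τ (predecessors xs)))
  where
  *-left-comm : ∀ x y z → x * (y * z) ≡ y * (x * z)
  *-left-comm = solve-∀ ℚ-ring

-- Stated for arbitrary σ₀ and σ₁ because assignments builds the two extensions of τ with pattern
-- lambdas local to Defs, which can only be characterised by their values.
spinProduct-extensions : ∀ {m} {σ₀ σ₁ : Fin (suc m) → Bool} {τ : Fin m → Bool} →
  σ₀ zero ≡ true → σ₁ zero ≡ false → (∀ i → σ₀ (suc i) ≡ τ i) → (∀ i → σ₁ (suc i) ≡ τ i) → ∀ xs →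
  ∑[ σ ← σ₀ ∷ σ₁ ∷ [] ] spinProduct σ xs ≡ (1ℚ + ε (parity (occurrences zero xs))) * spinProduct τ (predecessors xs)
spinProduct-extensions {σ₀ = σ₀} {σ₁} {τ} σ₀₀ σ₁₀ σ₀ₛ σ₁ₛ xs = begin
  spinProduct σ₀ xs + (spinProduct σ₁ xs + 0ℚ)
    ≡⟨ cong₂ (λ p q → p + (q + 0ℚ)) (spinProduct-split σ₀₀ σ₀ₛ xs) (spinProduct-split σ₁₀ σ₁ₛ xs) ⟩
  spin true ^ k * X + (spin false ^ k * X + 0ℚ)
    ≡⟨ cong₂ (λ p q → p * X + (q * X + 0ℚ)) (spin-true-^ k) (spin-false-^ k) ⟩
  1ℚ * X + (ε (parity k) * X + 0ℚ)
    ≡⟨ collect (ε (parity k)) X ⟩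
  (1ℚ + ε (parity k)) * X ∎
  where
  open ≡-Reasoning
  k = occurrences zero xs
  X = spinProduct τ (predecessors xs)
  collect : ∀ e x → 1ℚ * x + (e * x + 0ℚ) ≡ (1ℚ + e) * x
  collect = solve-∀ ℚ-ring

characterSum-suc : ∀ {m} (xs : List (Fin (suc m))) {p} → parity (occurrences zero xs) ≡ p →
  characterSum xs ≡ (1ℚ + ε p) * characterSum (predecessors xs)
characterSum-suc {m} xs refl =
  trans (∑-concatMap _ (assignments m) _)
    (trans (∑-cong (assignments m) (λ τ → spinProduct-extensions refl refl (λ _ → refl) (λ _ → refl) xs))
      (∑-*ˡ (assignments m) (1ℚ + ε (parity (occurrences zero xs))) (λ τ → spinProduct τ (predecessors xs))))

characterSum-pos : ∀ {m} (xs : List (Fin m)) → EvenOccurrences xs → 0ℚ < characterSum xs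
characterSum-pos {zero} [] even = ℚ.positive⁻¹ 1ℚ
characterSum-pos {suc m} xs even = begin-strict
  0ℚ                        <⟨ ℚ.+-mono-< IH IH ⟩
  rest + rest               ≡⟨ twice rest ⟨
  (1ℚ + ε 0ℙ) * rest        ≡⟨ characterSum-suc xs (even zero) ⟨
  characterSum xs           ∎
  where
  open ℚ.≤-Reasoning
  rest = characterSum (predecessors xs)
  IH = characterSum-pos (predecessors xs) (evenOccurrences-predecessors xs even)

characterSum-nonneg : ∀ {m} (xs : List (Fin m)) → 0ℚ ≤ characterSum xs
characterSum-nonneg {zero} [] = ℚ.<⇒≤ (ℚ.positive⁻¹ 1ℚ)
characterSum-nonneg {suc m} xs with parity (occurrences zero xs) in p≡
... | 0ℙ = begin
  0ℚ                        ≤⟨ ℚ.+-mono-≤ IH IH ⟩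
  rest + rest               ≡⟨ twice rest ⟨
  (1ℚ + ε 0ℙ) * rest        ≡⟨ characterSum-suc xs p≡ ⟨
  characterSum xs           ∎
  where
  open ℚ.≤-Reasoning
  rest = characterSum (predecessors xs)
  IH = characterSum-nonneg (predecessors xs)
... | 1ℙ = ℚ.≤-reflexive (sym (trans (characterSum-suc xs p≡) (ℚ.*-zeroˡ (characterSum (predecessors xs)))))

characterSum-¬even : ∀ {m} (xs : List (Fin m)) → ¬ EvenOccurrences xs → characterSum xs ≡ 0ℚ
characterSum-¬even {zero} [] ¬even = ⊥-elim (¬even evenOccurrences-[])
characterSum-¬even {suc m} xs ¬even with parity (occurrences zero xs) in p≡
... | 0ℙ = trans (characterSum-suc xs p≡) (trans (cong ((1ℚ + ε 0ℙ) *_) IH) (ℚ.*-zeroʳ (1ℚ + ε 0ℙ)))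
  where
  IH = characterSum-¬even (predecessors xs) (¬even ∘ evenOccurrences-from-predecessors xs p≡)
... | 1ℙ = trans (characterSum-suc xs p≡) (ℚ.*-zeroˡ (characterSum (predecessors xs)))

module _ (H : Graph) where

  Adjacent : Fin (n H) → Fin (n H) → Set
  Adjacent u v = adj H u v ≡ true

  CommonNeighbour : Fin (n H) → Fin (n H) → Set
  CommonNeighbour a b = ∃[ w ] Adjacent a w × Adjacent b w

  adjacent-sym : ∀ {u v} → Adjacent u v → Adjacent v u
  adjacent-sym {u} {v} uv = trans (Graph.sym H v u) uv

  ¬evenOccurrences-nonEdge-edge : ∀ {a b u v} → ¬ a ≡ b → ¬ Adjacent a b → Adjacent u v →
    ¬ EvenOccurrences (a ∷ b ∷ u ∷ v ∷ [])
  ¬evenOccurrences-nonEdge-edge a≢b ab̸ uv even with evenOccurrences-∷⁻ even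
  ... | here a≡b , _ = a≢b a≡b
  ... | there (here refl) , even′ = ab̸ (subst (Adjacent _) (sym (evenOccurrences-pair even′)) uv)
  ... | there (there (here refl)) , even′ = ab̸ (subst (Adjacent _) (sym (evenOccurrences-pair even′)) (adjacent-sym uv))

  evenOccurrences⇒commonNeighbour₄ : ∀ {a b x u v} → ¬ Adjacent a b → Adjacent a x → Adjacent u v →
    EvenOccurrences (b ∷ x ∷ u ∷ v ∷ []) → CommonNeighbour a b
  evenOccurrences⇒commonNeighbour₄ ab̸ ax uv even with evenOccurrences-∷⁻ even
  ... | here refl , _ = ⊥-elim (ab̸ ax)
  ... | there (here refl) , even′ = _ , ax , subst (Adjacent _) (sym (evenOccurrences-pair even′)) uv
  ... | there (there (here refl)) , even′ = _ , ax , subst (Adjacent _) (sym (evenOccurrences-pair even′)) (adjacent-sym uv)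

  evenOccurrences⇒commonNeighbour : ∀ {a b u v u′ v′} → ¬ a ≡ b → ¬ Adjacent a b → Adjacent u v → Adjacent u′ v′ →
    EvenOccurrences (a ∷ b ∷ u ∷ v ∷ u′ ∷ v′ ∷ []) → CommonNeighbour a b
  evenOccurrences⇒commonNeighbour {b = b} {u} {v} a≢b ab̸ uv u′v′ even with evenOccurrences-∷⁻ even
  ... | here a≡b , _ = ⊥-elim (a≢b a≡b)
  ... | there (here refl) , even′ = evenOccurrences⇒commonNeighbour₄ ab̸ uv u′v′ even′
  ... | there (there (here refl)) , even′ = evenOccurrences⇒commonNeighbour₄ ab̸ (adjacent-sym uv) u′v′ even′
  ... | there (there (there (here refl))) , even′ =
    evenOccurrences⇒commonNeighbour₄ ab̸ u′v′ uv (evenOccurrences-↭ (↭-prep b (shift _ (u ∷ v ∷ []) [])) even′)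
  ... | there (there (there (there (here refl)))) , even′ =
    evenOccurrences⇒commonNeighbour₄ ab̸ (adjacent-sym u′v′) uv
      (evenOccurrences-↭ (↭-prep b (shift _ (u ∷ v ∷ []) [])) even′)

  Edge : Set
  Edge = Fin (n H) × Fin (n H)

  edgesFrom : Fin (n H) → Fin (n H) → List Edge
  edgesFrom u v = if (toℕ u <ᵇ toℕ v) ∧ adj H u v then (u , v) ∷ [] else []

  edges : List Edge
  edges = concatMap (λ u → concatMap (edgesFrom u) (allFin (n H))) (allFin (n H))

  Joins : Edge → Fin (n H) → Fin (n H) → Set
  Joins e u v = e ≡ (u , v) ⊎ e ≡ (v , u)

  edgeProduct≡∏ : ∀ σ → edgeProduct H σ ≡ ∏ (map (λ e → Uval (σ (proj₁ e)) (σ (proj₂ e))) edges)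
  edgeProduct≡∏ σ = cong ∏ (sym (begin
    map factor edges
      ≡⟨ map-concatMap factor (λ u → concatMap (edgesFrom u) (allFin (n H))) (allFin (n H)) ⟩
    concatMap (λ u → map factor (concatMap (edgesFrom u) (allFin (n H)))) (allFin (n H))
      ≡⟨ concatMap-cong (λ u → trans (map-concatMap factor (edgesFrom u) (allFin (n H)))
                                      (concatMap-cong (λ v → map-if u v _) (allFin (n H)))) (allFin (n H)) ⟩
    concatMap (λ u → concatMap (λ v → if (toℕ u <ᵇ toℕ v) ∧ adj H u v then Uval (σ u) (σ v) ∷ [] else [])
                               (allFin (n H)))
              (allFin (n H)) ∎))
    where
    open ≡-Reasoning
    factor : Edge → Poly
    factor e = Uval (σ (proj₁ e)) (σ (proj₂ e))
    map-if : ∀ u v c → map factor (if c then (u , v) ∷ [] else []) ≡ (if c then Uval (σ u) (σ v) ∷ [] else [])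
    map-if u v true = refl
    map-if u v false = refl

  ∈-edges⁻ : ∀ {e} → e ∈ edges → Adjacent (proj₁ e) (proj₂ e)
  ∈-edges⁻ e∈ with satisfied (∈-concatMap⁻ (λ u → concatMap (edgesFrom u) (allFin (n H))) {allFin (n H)} e∈)
  ... | u , e∈from-u with satisfied (∈-concatMap⁻ (edgesFrom u) {allFin (n H)} e∈from-u)
  ...   | v , e∈uv with ∈-if-∧⁻ {x = u , v} (toℕ u <ᵇ toℕ v) (adj H u v) e∈uv
  ...     | uv , refl = uv

  ∈-edges⁺ : ∀ {u v} → toℕ u ℕ.< toℕ v → Adjacent u v → (u , v) ∈ edges
  ∈-edges⁺ {u} {v} u<v uv =
    ∈-concatMap-intro _ (∈-allFin u) (∈-concatMap-intro (edgesFrom u) (∈-allFin v) (∈-if-∧⁺ (ℕ.<⇒<ᵇ u<v) uv))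

  adjacent⇒edge : ∀ {u v} → Adjacent u v → ∃[ e ] e ∈ edges × Joins e u v
  adjacent⇒edge {u} {v} uv with ℕ.<-cmp (toℕ u) (toℕ v)
  ... | tri< u<v _ _ = (u , v) , ∈-edges⁺ u<v uv , inj₁ refl
  ... | tri≈ _ u≡v _ = ⊥-elim (not-¬ (Graph.loopless H u) (subst (Adjacent u) (sym (Fin.toℕ-injective u≡v)) uv))
  ... | tri> _ _ v<u = (v , u) , ∈-edges⁺ v<u (adjacent-sym uv) , inj₂ refl

-- The p²-coefficient of f − g

-- The test x_b ∈ J in cellIntegral is a function local to Defs that cannot be named; the (otherwise
-- unused) hypothesis on constant assignments is what lets unification infer it as E.
coeff-∑-cells : ∀ j {m} (a b : Fin m) (G S : (Fin m → Bool) → Poly) (E R : Bool → Bool)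
  (σs : List (Fin m → Bool)) →
  (∀ y → G (λ _ → y) ≡ (if y ∧ E y then S (λ _ → y) else [])) →
  (∀ σ → G σ ≡ (if σ a ∧ E (σ b) then S σ else [])) →
  (∀ y → E y ≡ R y) →
  coeff j (foldr _⊕_ [] (map G σs)) ≡ ∑[ σ ← σs ] 𝟙 (σ a) * 𝟙 (R (σ b)) * coeff j (S σ)
coeff-∑-cells j a b G S E R σs _ G≡ E≡R = trans (coeff-∑⊕ j G σs) (∑-cong σs cell)
  where
  cell : ∀ σ → coeff j (G σ) ≡ 𝟙 (σ a) * 𝟙 (R (σ b)) * coeff j (S σ)
  cell σ = begin
    coeff j (G σ)                                        ≡⟨ cong (coeff j) (G≡ σ) ⟩
    coeff j (if σ a ∧ E (σ b) then S σ else [])          ≡⟨ coeff-if j (σ a ∧ E (σ b)) (S σ) ⟩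
    𝟙 (σ a ∧ E (σ b)) * coeff j (S σ)                    ≡⟨ cong (_* coeff j (S σ)) (𝟙-∧ (σ a) (E (σ b))) ⟩
    𝟙 (σ a) * 𝟙 (E (σ b)) * coeff j (S σ)                ≡⟨ cong (λ y → 𝟙 (σ a) * 𝟙 y * coeff j (S σ)) (E≡R (σ b)) ⟩
    𝟙 (σ a) * 𝟙 (R (σ b)) * coeff j (S σ)                ∎
    where open ≡-Reasoning

coeff-f−g : ∀ j (H : Graph) (a b : Fin (n H)) → coeff j (f H a b) - coeff j (g H a b) ≡
  ∑[ σ ← assignments (n H) ] 𝟙 (σ a) * spin (σ b) * (half^ (n H) * coeff j (edgeProduct H σ))
coeff-f−g j H a b = begin
  coeff j (f H a b) - coeff j (g H a b)
    ≡⟨ cong₂ _-_ (coeff-∑-cells j a b _ _ _ (λ y → y) σs (λ _ → refl) (λ _ → refl) λ { true → refl ; false → refl })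
                 (coeff-∑-cells j a b _ _ _ not σs (λ _ → refl) (λ _ → refl) λ { true → refl ; false → refl }) ⟩
  (∑[ σ ← σs ] 𝟙 (σ a) * 𝟙 (σ b) * X σ) - (∑[ σ ← σs ] 𝟙 (σ a) * 𝟙 (not (σ b)) * X σ)
    ≡⟨ ∑-- σs _ _ ⟨
  ∑[ σ ← σs ] (𝟙 (σ a) * 𝟙 (σ b) * X σ - 𝟙 (σ a) * 𝟙 (not (σ b)) * X σ)
    ≡⟨ ∑-cong σs (λ σ → trans (part-difference (σ a) (σ b) (X σ))
                               (cong (𝟙 (σ a) * spin (σ b) *_) (coeff-scale j (half^ (n H)) (edgeProduct H σ)))) ⟩
  ∑[ σ ← σs ] 𝟙 (σ a) * spin (σ b) * (half^ (n H) * coeff j (edgeProduct H σ)) ∎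
  where
  open ≡-Reasoning
  σs = assignments (n H)
  X : (Fin (n H) → Bool) → ℚ
  X σ = coeff j (scale (half^ (n H)) (edgeProduct H σ))
  part-difference : ∀ x y c → 𝟙 x * 𝟙 y * c - 𝟙 x * 𝟙 (not y) * c ≡ 𝟙 x * spin y * c
  part-difference x true c = lemma (𝟙 x) c
    where
    lemma : ∀ u c → u * 1ℚ * c - u * 0ℚ * c ≡ u * 1ℚ * c
    lemma = solve-∀ ℚ-ring
  part-difference x false c = lemma (𝟙 x) c
    where
    lemma : ∀ u c → u * 0ℚ * c - u * 1ℚ * c ≡ u * (- 1ℚ) * c
    lemma = solve-∀ ℚ-ring

module _ (H : Graph) (a b : Fin (n H)) where

  private
    σs : List (Fin (n H) → Bool)
    σs = assignments (n H)

  edgeWeight : (Fin (n H) → Bool) → Edge H → ℚ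
  edgeWeight σ e = agreement (σ (proj₁ e)) (σ (proj₂ e))

  crossTerm : Edge H → Edge H → ℚ
  crossTerm e e′ = ∑[ σ ← σs ] 𝟙 (σ a) * spin (σ b) * (edgeWeight σ e * edgeWeight σ e′)

  crossTerms : ℚ
  crossTerms = ∑[ p ← pairs (edges H) ] crossTerm (proj₁ p) (proj₂ p)

  coeff₂-f−g : coeff 2 (f H a b) - coeff 2 (g H a b) ≡ half^ (n H) * (- 1ℚ) ^ length (edges H) * crossTerms
  coeff₂-f−g = begin
    coeff 2 (f H a b) - coeff 2 (g H a b)
      ≡⟨ coeff-f−g 2 H a b ⟩
    ∑[ σ ← σs ] 𝟙 (σ a) * spin (σ b) * (half^ (n H) * coeff 2 (edgeProduct H σ))
      ≡⟨ ∑-cong σs (λ σ → cong (λ c → 𝟙 (σ a) * spin (σ b) * (half^ (n H) * c))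
                                (trans (cong (coeff 2) (edgeProduct≡∏ H σ))
                                       (coeff₂-∏Uval (σ ∘ proj₁) (σ ∘ proj₂) (edges H)))) ⟩
    ∑[ σ ← σs ] 𝟙 (σ a) * spin (σ b) * (half^ (n H) * (± * ∑ (pairs (edges H)) (W σ)))
      ≡⟨ ∑-cong σs (λ σ → trans (pull-out (𝟙 (σ a) * spin (σ b)) (half^ (n H)) ± (∑ (pairs (edges H)) (W σ)))
                                (cong (c *_) (sym (∑-*ˡ (pairs (edges H)) (𝟙 (σ a) * spin (σ b)) (W σ))))) ⟩
    ∑[ σ ← σs ] c * (∑[ p ← pairs (edges H) ] 𝟙 (σ a) * spin (σ b) * W σ p)
      ≡⟨ ∑-*ˡ σs c _ ⟩
    c * (∑[ σ ← σs ] ∑[ p ← pairs (edges H) ] 𝟙 (σ a) * spin (σ b) * W σ p)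
      ≡⟨ cong (c *_) (∑-comm σs (pairs (edges H)) _) ⟩
    c * crossTerms ∎
    where
    open ≡-Reasoning
    ± = (- 1ℚ) ^ length (edges H)
    c = half^ (n H) * ±
    W : (Fin (n H) → Bool) → Edge H × Edge H → ℚ
    W σ p = edgeWeight σ (proj₁ p) * edgeWeight σ (proj₂ p)
    pull-out : ∀ x h s w → x * (h * (s * w)) ≡ (h * s) * (x * w)
    pull-out = solve-∀ ℚ-ring

  leadingMonomial : Edge H → Edge H → List (Fin (n H))
  leadingMonomial e e′ = a ∷ b ∷ proj₁ e ∷ proj₂ e ∷ proj₁ e′ ∷ proj₂ e′ ∷ []

  otherMonomials : Fin (n H) → Fin (n H) → Fin (n H) → Fin (n H) → List (List (Fin (n H)))
  otherMonomials u v u′ v′ =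
    (b ∷ []) ∷ (b ∷ u ∷ v ∷ []) ∷ (b ∷ u′ ∷ v′ ∷ []) ∷ (b ∷ u ∷ v ∷ u′ ∷ v′ ∷ [])
    ∷ (a ∷ b ∷ []) ∷ (a ∷ b ∷ u ∷ v ∷ []) ∷ (a ∷ b ∷ u′ ∷ v′ ∷ []) ∷ []

  monomials : Fin (n H) → Fin (n H) → Fin (n H) → Fin (n H) → List (List (Fin (n H)))
  monomials u v u′ v′ = leadingMonomial (u , v) (u′ , v′) ∷ otherMonomials u v u′ v′

  crossTerm-expansion : ∀ u v u′ v′ →
    crossTerm (u , v) (u′ , v′) ≡ ½ * (∑[ xs ← monomials u v u′ v′ ] characterSum xs)
  crossTerm-expansion u v u′ v′ =
    trans (∑-cong σs (λ σ → trans (cong (λ i → i * spin (σ b) * _) (𝟙≡½[1+spin] (σ a)))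
                                  (expand (spin (σ a)) (spin (σ b)) (spin (σ u)) (spin (σ v))
                                          (spin (σ u′)) (spin (σ v′)))))
      (trans (∑-*ˡ σs ½ (λ σ → ∑ (monomials u v u′ v′) (spinProduct σ)))
             (cong (½ *_) (∑-comm σs (monomials u v u′ v′) spinProduct)))
    where
    expand : ∀ A B U V U′ V′ → ½ * (1ℚ + A) * B * ((1ℚ + U * V) * (1ℚ + U′ * V′)) ≡
      ½ * (A * (B * (U * (V * (U′ * (V′ * 1ℚ))))) + (B * 1ℚ + (B * (U * (V * 1ℚ)) + (B * (U′ * (V′ * 1ℚ))
           + (B * (U * (V * (U′ * (V′ * 1ℚ)))) + (A * (B * 1ℚ) + (A * (B * (U * (V * 1ℚ))) + (A * (B * (U′ * (V′ * 1ℚ)))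
           + 0ℚ))))))))
    expand = solve-∀ ℚ-ring

  crossTerm-edges : ¬ a ≡ b → ¬ Adjacent H a b → ∀ {u v u′ v′} → Adjacent H u v → Adjacent H u′ v′ →
    crossTerm (u , v) (u′ , v′) ≡ ½ * characterSum (leadingMonomial (u , v) (u′ , v′))
  crossTerm-edges a≢b ab̸ {u} {v} {u′} {v′} uv u′v′ =
    trans (crossTerm-expansion u v u′ v′)
          (cong (½ *_) (trans (cong (characterSum six +_) (trans (∑-cong-∈ others vanishes) (∑-zero others)))
                              (ℚ.+-identityʳ (characterSum six))))
    where
    six = leadingMonomial (u , v) (u′ , v′)
    others = otherMonomials u v u′ v′
    odd : ∀ xs → parity (length xs) ≡ 1ℙ → characterSum xs ≡ 0ℚ
    odd xs odd-length = characterSum-¬even xs (¬evenOccurrences-odd xs odd-length)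
    vanishes : ∀ {xs} → xs ∈ others → characterSum xs ≡ 0ℚ
    vanishes (here refl) = odd (b ∷ []) refl
    vanishes (there (here refl)) = odd (b ∷ u ∷ v ∷ []) refl
    vanishes (there (there (here refl))) = odd (b ∷ u′ ∷ v′ ∷ []) refl
    vanishes (there (there (there (here refl)))) = odd (b ∷ u ∷ v ∷ u′ ∷ v′ ∷ []) refl
    vanishes (there (there (there (there (here refl))))) =
      characterSum-¬even (a ∷ b ∷ []) (a≢b ∘ evenOccurrences-pair)
    vanishes (there (there (there (there (there (here refl)))))) =
      characterSum-¬even (a ∷ b ∷ u ∷ v ∷ []) (¬evenOccurrences-nonEdge-edge H a≢b ab̸ uv)
    vanishes (there (there (there (there (there (there (here refl))))))) =
      characterSum-¬even (a ∷ b ∷ u′ ∷ v′ ∷ []) (¬evenOccurrences-nonEdge-edge H a≢b ab̸ u′v′)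

  edgeWeight-joins : ∀ σ {e u v} → Joins H e u v → edgeWeight σ e ≡ edgeWeight σ (u , v)
  edgeWeight-joins σ (inj₁ refl) = refl
  edgeWeight-joins σ {u = u} {v} (inj₂ refl) = agreement-comm (σ v) (σ u)

  crossTerm-joins : ∀ {e₁ e₂ u v u′ v′} → Joins H e₁ u v → Joins H e₂ u′ v′ →
    crossTerm e₁ e₂ ≡ crossTerm (u , v) (u′ , v′)
  crossTerm-joins e₁-uv e₂-u′v′ = ∑-cong σs (λ σ →
    cong (𝟙 (σ a) * spin (σ b) *_) (cong₂ _*_ (edgeWeight-joins σ e₁-uv) (edgeWeight-joins σ e₂-u′v′)))

  crossTerm-comm : ∀ e e′ → crossTerm e e′ ≡ crossTerm e′ e
  crossTerm-comm e e′ = ∑-cong σs (λ σ →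
    cong (𝟙 (σ a) * spin (σ b) *_) (ℚ.*-comm (edgeWeight σ e) (edgeWeight σ e′)))

  private
    ½*-nonneg : ∀ {x} → 0ℚ ≤ x → 0ℚ ≤ ½ * x
    ½*-nonneg = ℚ.*-monoˡ-≤-nonNeg ½

    ½*-pos : ∀ {x} → 0ℚ < x → 0ℚ < ½ * x
    ½*-pos = ℚ.*-monoʳ-<-pos ½

  module _ (a≢b : ¬ a ≡ b) (ab̸ : ¬ Adjacent H a b) where

    crossTerm-nonneg : ∀ {p} → p ∈ pairs (edges H) → 0ℚ ≤ crossTerm (proj₁ p) (proj₂ p)
    crossTerm-nonneg p∈ with ∈-pairs⁻ (edges H) p∈
    ... | e∈ , e′∈ = subst (0ℚ ≤_) (sym (crossTerm-edges a≢b ab̸ (∈-edges⁻ H e∈) (∈-edges⁻ H e′∈)))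
                                  (½*-nonneg (characterSum-nonneg (leadingMonomial _ _)))

    crossTerms≡0 : ¬ CommonNeighbour H a b → crossTerms ≡ 0ℚ
    crossTerms≡0 no-common = trans (∑-cong-∈ (pairs (edges H)) term≡0) (∑-zero (pairs (edges H)))
      where
      term≡0 : ∀ {p} → p ∈ pairs (edges H) → crossTerm (proj₁ p) (proj₂ p) ≡ 0ℚ
      term≡0 p∈ with ∈-pairs⁻ (edges H) p∈
      ... | e∈ , e′∈ = trans (crossTerm-edges a≢b ab̸ uv u′v′) (trans (cong (½ *_) vanishes) (ℚ.*-zeroʳ ½))
        where
        uv = ∈-edges⁻ H e∈
        u′v′ = ∈-edges⁻ H e′∈
        vanishes = characterSum-¬even (leadingMonomial _ _)
                     (no-common ∘ evenOccurrences⇒commonNeighbour H a≢b ab̸ uv u′v′)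

    joins-distinct : ∀ {e₁ e₂ w} → Joins H e₁ a w → Joins H e₂ b w → ¬ e₁ ≡ e₂
    joins-distinct (inj₁ refl) (inj₁ refl) refl = a≢b refl
    joins-distinct (inj₁ refl) (inj₂ refl) refl = a≢b refl
    joins-distinct (inj₂ refl) (inj₁ refl) refl = a≢b refl
    joins-distinct (inj₂ refl) (inj₂ refl) refl = a≢b refl

    crossTerm-commonNeighbour-pos : ∀ {e₁ e₂ w} → Adjacent H a w → Adjacent H b w →
      Joins H e₁ a w → Joins H e₂ b w → 0ℚ < crossTerm e₁ e₂
    crossTerm-commonNeighbour-pos {w = w} aw bw e₁-aw e₂-bw =
      subst (0ℚ <_) (sym (trans (crossTerm-joins e₁-aw e₂-bw) (crossTerm-edges a≢b ab̸ aw bw)))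
            (½*-pos (characterSum-pos (leadingMonomial (a , w) (b , w)) (evenOccurrences-abawbw a b w)))

    crossTerms-pos : CommonNeighbour H a b → 0ℚ < crossTerms
    crossTerms-pos (w , aw , bw) with adjacent⇒edge H aw | adjacent⇒edge H bw
    ... | e₁ , e₁∈ , e₁-aw | e₂ , e₂∈ , e₂-bw =
      Sum.[ (λ p∈ → ∑-pos (pairs (edges H)) p∈ pos crossTerm-nonneg)
          , (λ p∈ → ∑-pos (pairs (edges H)) p∈ (subst (0ℚ <_) (crossTerm-comm e₁ e₂) pos) crossTerm-nonneg)
          ]′ (∈-pairs⁺ e₁∈ e₂∈ (joins-distinct e₁-aw e₂-bw))
      where
      pos : 0ℚ < crossTerm e₁ e₂
      pos = crossTerm-commonNeighbour-pos aw bw e₁-aw e₂-bw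

x*y≡0⇒y≡0 : ∀ u c {x} → u * c ≡ 1ℚ → c * x ≡ 0ℚ → x ≡ 0ℚ
x*y≡0⇒y≡0 u c {x} uc≡1 cx≡0 = begin
  x              ≡⟨ ℚ.*-identityˡ x ⟨
  1ℚ * x         ≡⟨ cong (_* x) uc≡1 ⟨
  (u * c) * x    ≡⟨ ℚ.*-assoc u c x ⟩
  u * (c * x)    ≡⟨ cong (u *_) cx≡0 ⟩
  u * 0ℚ         ≡⟨ ℚ.*-zeroʳ u ⟩
  0ℚ             ∎
  where open ≡-Reasoning

two^*half^ : ∀ k → (1ℚ + 1ℚ) ^ k * half^ k ≡ 1ℚ
two^*half^ zero = refl
two^*half^ (suc k) = trans (regroup ((1ℚ + 1ℚ) ^ k) (half^ k)) (two^*half^ k)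
  where
  regroup : ∀ x y → ((1ℚ + 1ℚ) * x) * (½ * y) ≡ x * y
  regroup = solve-∀ ℚ-ring

half^*sign-invertible : ∀ m k → ((1ℚ + 1ℚ) ^ m * (- 1ℚ) ^ k) * (half^ m * (- 1ℚ) ^ k) ≡ 1ℚ
half^*sign-invertible m k =
  trans (interchange ((1ℚ + 1ℚ) ^ m) ((- 1ℚ) ^ k) (half^ m) ((- 1ℚ) ^ k)) (cong₂ _*_ (two^*half^ m) (-1^*-1^ k))
  where
  interchange : ∀ x y z w → (x * y) * (z * w) ≡ (x * z) * (y * w)
  interchange = solve-∀ ℚ-ring

module _ (H : Graph) (a b : Fin (n H)) where

  private
    c : ℚ
    c = half^ (n H) * (- 1ℚ) ^ length (edges H)

  coeff₂-f≡g⇒crossTerms≡0 : coeff 2 (f H a b) ≡ coeff 2 (g H a b) → crossTerms H a b ≡ 0ℚ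
  coeff₂-f≡g⇒crossTerms≡0 f₂≡g₂ =
    x*y≡0⇒y≡0 ((1ℚ + 1ℚ) ^ n H * (- 1ℚ) ^ length (edges H)) c (half^*sign-invertible (n H) (length (edges H)))
      (trans (sym (coeff₂-f−g H a b)) (trans (cong (_- coeff 2 (g H a b)) f₂≡g₂) (ℚ.+-inverseʳ (coeff 2 (g H a b)))))

  crossTerms≡0⇒coeff₂-f≡g : crossTerms H a b ≡ 0ℚ → coeff 2 (f H a b) ≡ coeff 2 (g H a b)
  crossTerms≡0⇒coeff₂-f≡g crossTerms≡0 = Group.x∙y⁻¹≈ε⇒x≈y _ _
    (trans (coeff₂-f−g H a b) (trans (cong (c *_) crossTerms≡0) (ℚ.*-zeroʳ c)))

corollary3p2 : (H : Graph) (a b : Fin (n H)) → ¬ (a ≡ b) → adj H a b ≡ false →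
    ((coeff 2 (f H a b) ≡ coeff 2 (g H a b) → CommonNbrsEmpty H a b)
    × (CommonNbrsEmpty H a b → coeff 2 (f H a b) ≡ coeff 2 (g H a b)))
corollary3p2 H a b a≢b ab≡false = equal⇒disjoint , disjoint⇒equal
  where
  ab̸ : ¬ Adjacent H a b
  ab̸ = not-¬ ab≡false

  equal⇒disjoint : coeff 2 (f H a b) ≡ coeff 2 (g H a b) → CommonNbrsEmpty H a b
  equal⇒disjoint f₂≡g₂ w aw bw =
    ℚ.<-irrefl (sym (coeff₂-f≡g⇒crossTerms≡0 H a b f₂≡g₂)) (crossTerms-pos H a b a≢b ab̸ (w , aw , bw))

  disjoint⇒equal : CommonNbrsEmpty H a b → coeff 2 (f H a b) ≡ coeff 2 (g H a b)
  disjoint⇒equal no-common =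
    crossTerms≡0⇒coeff₂-f≡g H a b (crossTerms≡0 H a b a≢b ab̸ (λ (w , aw , bw) → no-common w aw bw))
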